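{- Let $\ell$, $r$ and $n$ be positive integers, and let $P=[x_1,\ldots,x_\ell]\,[y_1,\ldots,y_r]_n$ be a position of Simple Chopsticks. If $\ell>r$ and Left moves first in $P$, then Left has a winning strategy. Symmetrically, if $\ell<r$ and Right moves first in $P$, then Right has a winning strategy.
   Context: Simple Chopsticks. Fix a positive integer $n$, the finger count. A position $[x_1,\ldots,x_\ell]\,[y_1,\ldots,y_r]_n$ consists of a finite non-decreasing sequence $(x_1,\ldots,x_\ell)$ of integers in $\{1,\ldots,n\}$ (Left's hands) and a finite non-decreasing sequence $(y_1,\ldots,y_r)$ of integers in $\{1,\ldots,n\}$ (Right's hands); either list may be empty. Left's moves: for any $i\in\{1,\ldots,\ell\}$, $j\in\{1,\ldots,r\}$, replace $y_j$ by $y_j+x_i$ (re-sorting), removing the entry from Right's list if $y_j+x_i>n$. Right's moves: for any $i,j$, replace $x_i$ by $x_i+y_j$, removing it if $x_i+y_j>n$. No moves are available when either list is empty. Normal play: a player who cannot move on their turn loses. -}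

module Defs where

open import Data.Nat using (ℕ; _+_; _≤_; _≤ᵇ_)
open import Data.Bool using (if_then_else_)
open import Data.List using (List; []; _∷_; length; lookup; removeAt)
open import Data.List.Relation.Unary.All using (All)
open import Data.List.Relation.Unary.Linked using (Linked)
open import Data.Fin using (Fin)
open import Data.Product using (Σ; _×_)

insert : ℕ → List ℕ → List ℕ
insert a [] = a ∷ []
insert a (b ∷ bs) = if a ≤ᵇ b then a ∷ b ∷ bs else b ∷ insert a bs

ValidHands : ℕ → List ℕ → Set
ValidHands n hs = Linked _≤_ hs × All (λ h → 1 ≤ h × h ≤ n) hs

attack : (n : ℕ) (att def : List ℕ) → Fin (length att) → Fin (length def) → List ℕ
attack n att def i j =
  let v = lookup def j + lookup att i
      rest = removeAt def j
  in if v ≤ᵇ n then insert v rest else rest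

-- Normal-play outcome, inductively (the game is finite):
-- `MoverWins n mov opp`: the player to move, holding hands `mov` against
--   opponent hands `opp`, has a winning strategy.
-- `MoverLoses n mov opp`: the opponent of the player to move has a winning
--   strategy (every move leads to a position the opponent wins as mover).
-- A player with no available move (either list empty) loses.
data MoverWins (n : ℕ) : List ℕ → List ℕ → Set
data MoverLoses (n : ℕ) : List ℕ → List ℕ → Set

data MoverWins n where
  move : ∀ {mov opp} (i : Fin (length mov)) (j : Fin (length opp)) →
         MoverLoses n (attack n mov opp i j) mov → MoverWins n mov opp

data MoverLoses n where
  allMoves : ∀ {mov opp} →
             ((i : Fin (length mov)) (j : Fin (length opp)) →
               MoverWins n (attack n mov opp i j) mov) →
             MoverLoses n mov opp

LeftWinsMovingFirst : ℕ → List ℕ → List ℕ → Set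
LeftWinsMovingFirst n xs ys = MoverWins n xs ys

RightWinsMovingFirst : ℕ → List ℕ → List ℕ → Set
RightWinsMovingFirst n xs ys = MoverWins n ys xs

{-# OPTIONS --safe #-}
module Submission where

-- Induction on the potential, the sum of n + 1 ∸ h over all hands h in play, which every move
-- decreases. The player to move, having more hands, removes an opposing hand if it can; the
-- opponent can take back at most one hand, so the mover keeps the majority. Otherwise no hand can
-- remove an opposing one, and the mover taps an opposing hand in such a way that, should the new
-- hand remove one of the mover's hands, a remaining hand of the mover removes it in turn. After
-- that exchange no hand can remove an opposing one again and the mover still has more hands.

open import Defs
open import Data.Bool using (true; false; if_then_else_)
open import Data.Bool.Properties using (T-≡; ¬-not)
open import Data.Fin using (Fin; zero; suc; fromℕ<; _≟_)
open import Data.Fin.Properties using (any?; toℕ<n)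
open import Data.List using (List; []; _∷_; length; lookup; removeAt; map)
open import Data.List.Properties using (length-removeAt′)
open import Data.List.Membership.Propositional using (_∈_)
open import Data.List.Membership.Propositional.Properties using (∈-lookup)
open import Data.List.Relation.Binary.Permutation.Propositional
  using (_↭_; prep; swap; ↭-refl; ↭-sym; ↭-trans)
open import Data.List.Relation.Binary.Permutation.Propositional.Properties
  using (∈-resp-↭; All-resp-↭; map⁺; ↭-length; drop-∷)
open import Data.List.Relation.Binary.Subset.Propositional using (_⊆_)
open import Data.List.Relation.Unary.All as All using (All; _∷_)
open import Data.List.Relation.Unary.All.Properties using (anti-mono)
open import Data.List.Relation.Unary.Any using (here; there; index)
open import Data.List.Relation.Unary.Any.Properties using (lookup-index)
open import Data.Nat
  using (ℕ; suc; _+_; _∸_; _<_; _≤_; _≤ᵇ_; _<?_; _≤?_; z≤n; s≤s; s≤s⁻¹; z<s)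
open import Data.Nat.Induction using (<-wellFounded)
open import Data.Nat.ListAction using (sum)
open import Data.Nat.ListAction.Properties using (sum-↭)
open import Data.Nat.Properties hiding (_≟_)
open import Algebra.Properties.CommutativeSemigroup +-commutativeSemigroup using (xy∙z≈xz∙y)
open import Data.Product using (_×_; _,_; proj₁; ∃-syntax; ∃₂)
open import Data.Sum using (_⊎_; inj₁; inj₂)
open import Function using (_∘_; id; Equivalence)
open import Induction.WellFounded using (Acc; acc)
open import Relation.Nullary using (yes; no; ¬?; contradiction)
open import Relation.Nullary.Decidable using (_×-dec_)
open import Relation.Binary.PropositionalEquality

module _ {A : Set} where

  removeAt-↭ : ∀ (xs : List A) i → xs ↭ lookup xs i ∷ removeAt xs i
  removeAt-↭ (x ∷ xs) zero    = ↭-refl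
  removeAt-↭ (x ∷ xs) (suc i) =
    ↭-trans (prep x (removeAt-↭ xs i)) (swap x (lookup xs i) ↭-refl)

  removeAt-⊆ : ∀ (xs : List A) i → removeAt xs i ⊆ xs
  removeAt-⊆ xs i = ∈-resp-↭ (↭-sym (removeAt-↭ xs i)) ∘ there

  removeAt-cancel : ∀ (xs : List A) i {ys} → xs ↭ lookup xs i ∷ ys → removeAt xs i ↭ ys
  removeAt-cancel xs i xs↭ = drop-∷ (↭-trans (↭-sym (removeAt-↭ xs i)) xs↭)

  lookup-∈-removeAt : ∀ (xs : List A) {i j} → i ≢ j → lookup xs i ∈ removeAt xs j
  lookup-∈-removeAt (x ∷ xs) {zero}  {zero}  i≢j = contradiction refl i≢j
  lookup-∈-removeAt (x ∷ xs) {zero}  {suc j} _   = here refl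
  lookup-∈-removeAt (x ∷ xs) {suc i} {zero}  _   = ∈-lookup i
  lookup-∈-removeAt (x ∷ xs) {suc i} {suc j} i≢j =
    there (lookup-∈-removeAt xs (i≢j ∘ cong suc))

insert-↭ : ∀ v xs → insert v xs ↭ v ∷ xs
insert-↭ v []       = ↭-refl
insert-↭ v (x ∷ xs) with v ≤ᵇ x
... | true  = ↭-refl
... | false = ↭-trans (prep x (insert-↭ v xs)) (swap x v ↭-refl)

distinct-ordered-indices : ∀ (xs : List ℕ) → 1 < length xs →
                           ∃₂ λ i m → i ≢ m × lookup xs i ≤ lookup xs m
distinct-ordered-indices (x₀ ∷ x₁ ∷ xs) _ with x₀ ≤? x₁
... | yes x₀≤x₁ = zero , suc zero , (λ ()) , x₀≤x₁
... | no  x₀≰x₁ = suc zero , zero , (λ ()) , <⇒≤ (≰⇒> x₀≰x₁)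
distinct-ordered-indices (_ ∷ []) (s≤s ())

attack-sum : (att def : List ℕ) → Fin (length att) → Fin (length def) → ℕ
attack-sum att def i j = lookup def j + lookup att i

module _ (n : ℕ) where

  attack-tap : ∀ att def i j → attack-sum att def i j ≤ n →
               attack n att def i j ≡ insert (attack-sum att def i j) (removeAt def j)
  attack-tap att def i j v≤n = cong (if_then _ else _) (Equivalence.to T-≡ (≤⇒≤ᵇ v≤n))

  attack-kill : ∀ att def i j → n < attack-sum att def i j →
                attack n att def i j ≡ removeAt def j
  attack-kill att def i j n<v = cong (if_then _ else _)
    (¬-not λ v≤ᵇn → <⇒≱ n<v (≤ᵇ⇒≤ _ n (Equivalence.from T-≡ v≤ᵇn)))

  attack-tap-↭ : ∀ att def i j → attack-sum att def i j ≤ n →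
                 attack n att def i j ↭ attack-sum att def i j ∷ removeAt def j
  attack-tap-↭ att def i j v≤n =
    subst (_↭ _) (sym (attack-tap att def i j v≤n)) (insert-↭ _ (removeAt def j))

  attack-kill-⊆ : ∀ att def i j → n < attack-sum att def i j → attack n att def i j ⊆ def
  attack-kill-⊆ att def i j n<v =
    removeAt-⊆ def j ∘ subst (_ ∈_) (attack-kill att def i j n<v)

  length-attack-tap : ∀ att def i j → attack-sum att def i j ≤ n →
                      length (attack n att def i j) ≡ length def
  length-attack-tap att def i j v≤n =
    trans (↭-length (attack-tap-↭ att def i j v≤n)) (sym (length-removeAt′ def j))

  length-attack-kill : ∀ att def i j → n < attack-sum att def i j →
                       suc (length (attack n att def i j)) ≡ length def
  length-attack-kill att def i j n<v =
    trans (cong (suc ∘ length) (attack-kill att def i j n<v)) (sym (length-removeAt′ def j))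

  length-attack-≥ : ∀ att def i j → length def ≤ suc (length (attack n att def i j))
  length-attack-≥ att def i j with attack-sum att def i j ≤? n
  ... | yes v≤n = ≤-trans (≤-reflexive (sym (length-attack-tap att def i j v≤n))) (n≤1+n _)
  ... | no  v≰n = ≤-reflexive (sym (length-attack-kill att def i j (≰⇒> v≰n)))

  Positive : List ℕ → Set
  Positive = All (1 ≤_)

  positive-attack : ∀ att def i j → Positive att → Positive def →
                    Positive (attack n att def i j)
  positive-attack att def i j pa pd with attack-sum att def i j ≤? n
  ... | yes v≤n = All-resp-↭ (↭-sym (attack-tap-↭ att def i j v≤n))
    (≤-trans (All.lookup pa (∈-lookup i)) (m≤n+m _ _) ∷ anti-mono (removeAt-⊆ def j) pd)
  ... | no  v≰n = anti-mono (attack-kill-⊆ att def i j (≰⇒> v≰n)) pd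

  -- The `suc` makes removing a hand decrease the potential, too.
  weight : ℕ → ℕ
  weight h = suc (n ∸ h)

  potential : List ℕ → ℕ
  potential = sum ∘ map weight

  potential-↭ : ∀ {xs ys} → xs ↭ ys → potential xs ≡ potential ys
  potential-↭ xs↭ys = sum-↭ (map⁺ weight xs↭ys)

  potential-attack : ∀ att def i j → Positive att →
                     potential (attack n att def i j) < potential def
  potential-attack att def i j pa with attack-sum att def i j ≤? n
  ... | yes v≤n = begin-strict
    potential (attack n att def i j)                 ≡⟨ potential-↭ (attack-tap-↭ att def i j v≤n) ⟩
    weight (attack-sum att def i j) + potential rest <⟨ +-monoˡ-< _ (s≤s (∸-monoʳ-< d<v v≤n)) ⟩
    weight (lookup def j) + potential rest           ≡⟨ potential-↭ (removeAt-↭ def j) ⟨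
    potential def                                    ∎
    where
    open ≤-Reasoning
    rest = removeAt def j
    d<v = m<m+n (lookup def j) (All.lookup pa (∈-lookup i))
  ... | no  v≰n = begin-strict
    potential (attack n att def i j)       ≡⟨ cong potential (attack-kill att def i j (≰⇒> v≰n)) ⟩
    potential rest                         <⟨ m<n+m _ z<s ⟩
    weight (lookup def j) + potential rest ≡⟨ potential-↭ (removeAt-↭ def j) ⟨
    potential def                          ∎
    where
    open ≤-Reasoning
    rest = removeAt def j

  Harmless : List ℕ → List ℕ → Set
  Harmless xs ys = ∀ {x y} → x ∈ xs → y ∈ ys → x + y ≤ n

  harmless-sym : ∀ {xs ys} → Harmless xs ys → Harmless ys xs
  harmless-sym harmless {y} {x} y∈ys x∈xs = subst (_≤ n) (+-comm x y) (harmless x∈xs y∈ys)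

  harmless-⊆ : ∀ {xs ys xs′ ys′} → xs′ ⊆ xs → ys′ ⊆ ys → Harmless xs ys → Harmless xs′ ys′
  harmless-⊆ xs′⊆xs ys′⊆ys harmless x∈ y∈ = harmless (xs′⊆xs x∈) (ys′⊆ys y∈)

  harmless-attack-sum : ∀ att def i j → Harmless def att → attack-sum att def i j ≤ n
  harmless-attack-sum att def i j harmless = harmless (∈-lookup j) (∈-lookup i)

  kill-or-harmless : ∀ att def → (∃₂ λ i j → n < attack-sum att def i j) ⊎ Harmless def att
  kill-or-harmless att def with any? (λ i → any? (λ j → n <? attack-sum att def i j))
  ... | yes kill    = inj₁ kill
  ... | no  no-kill = inj₂ λ d∈def a∈att →
    subst (_≤ n) (sym (cong₂ _+_ (lookup-index d∈def) (lookup-index a∈att)))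
      (≮⇒≥ λ n<v → no-kill (index a∈att , index d∈def , n<v))

  CanRetaliate : List ℕ → ℕ → Set
  CanRetaliate xs v = ∀ b → n < lookup xs b + v → ∃[ x ] x ∈ removeAt xs b × n < v + x

  retaliation-by-pair : ∀ c xs {i m} → i ≢ m → lookup xs m ≤ lookup xs i →
                        n < (c + lookup xs i) + lookup xs m →
                        CanRetaliate xs (c + lookup xs i)
  retaliation-by-pair c xs {i} {m} i≢m xm≤xi n<v+xm b _ with b ≟ m
  ... | yes refl = lookup xs i , lookup-∈-removeAt xs i≢m ,
                   <-≤-trans n<v+xm (+-monoʳ-≤ (c + lookup xs i) xm≤xi)
  ... | no  b≢m  = lookup xs m , lookup-∈-removeAt xs (b≢m ∘ sym) , n<v+xm

  retaliation-without-pair : ∀ c xs {i m} →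
                             (∀ {i′ m′} → i′ ≢ m′ → (c + lookup xs i′) + lookup xs m′ ≤ n) →
                             i ≢ m → lookup xs i ≤ lookup xs m → CanRetaliate xs (c + lookup xs i)
  retaliation-without-pair c xs {i} {m} no-pair i≢m xi≤xm b n<xb+v =
    contradiction n<xb+v (≤⇒≯ xb+v≤n)
    where
    xb+v≤n : lookup xs b + (c + lookup xs i) ≤ n
    xb+v≤n with b ≟ i
    ... | yes refl = begin
      lookup xs i + (c + lookup xs i)  ≡⟨ +-comm (lookup xs i) _ ⟩
      (c + lookup xs i) + lookup xs i  ≤⟨ +-monoʳ-≤ (c + lookup xs i) xi≤xm ⟩
      (c + lookup xs i) + lookup xs m  ≤⟨ no-pair i≢m ⟩
      n                                ∎
      where open ≤-Reasoning
    ... | no  b≢i  = subst (_≤ n) (+-comm _ (lookup xs b)) (no-pair (b≢i ∘ sym))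

  -- Tap c with the larger hand of a pair of hands that together with c exceed n; if there is no
  -- such pair, with the smaller of any two hands, so that the new hand can remove nothing.
  ∃-retaliating-tap : ∀ c xs → 1 < length xs → ∃[ i ] CanRetaliate xs (c + lookup xs i)
  ∃-retaliating-tap c xs 1<∣xs∣ with any? (λ i → any? (λ m →
    ¬? (i ≟ m) ×-dec (n <? (c + lookup xs i) + lookup xs m)))
  ... | yes (i , m , i≢m , n<v+xm) with lookup xs m ≤? lookup xs i
  ...   | yes xm≤xi = i , retaliation-by-pair c xs i≢m xm≤xi n<v+xm
  ...   | no  xm≰xi = m , retaliation-by-pair c xs (i≢m ∘ sym) (<⇒≤ (≰⇒> xm≰xi))
                            (subst (n <_) (xy∙z≈xz∙y c (lookup xs i) (lookup xs m)) n<v+xm)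
  ∃-retaliating-tap c xs 1<∣xs∣ | no no-pair with distinct-ordered-indices xs 1<∣xs∣
  ... | i , m , i≢m , xi≤xm = i , retaliation-without-pair c xs
          (λ i′≢m′ → ≮⇒≥ λ n<v+x → no-pair (_ , _ , i′≢m′ , n<v+x)) i≢m xi≤xm

  OutnumberingWins : List ℕ → List ℕ → Set
  OutnumberingWins xs ys =
    Positive xs → Positive ys → 1 ≤ length ys → length ys < length xs → MoverWins n xs ys

  OutnumberingWinsBelow : ℕ → Set
  OutnumberingWinsBelow k = ∀ {xs ys} → potential xs + potential ys < k → OutnumberingWins xs ys

  below-≤ : ∀ {k l} → k ≤ l → OutnumberingWinsBelow l → OutnumberingWinsBelow k
  below-≤ k≤l ih p<k = ih (<-≤-trans p<k k≤l)

  below-after-attack : ∀ xs ys i j → Positive xs →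
                       OutnumberingWinsBelow (potential xs + potential ys) →
                       OutnumberingWinsBelow (potential xs + potential (attack n xs ys i j))
  below-after-attack xs ys i j px =
    below-≤ (<⇒≤ (+-monoʳ-< (potential xs) (potential-attack xs ys i j px)))

  wins-after-outnumbered-reply : ∀ opp mov i j →
                                 OutnumberingWinsBelow (potential opp + potential mov) →
                                 Positive opp → Positive mov →
                                 length mov < length (attack n mov opp i j) →
                                 MoverWins n (attack n mov opp i j) mov
  wins-after-outnumbered-reply opp mov i j ih po pm mov<opp′ =
    ih (+-monoˡ-< (potential mov) (potential-attack mov opp i j pm))
       (positive-attack mov opp i j pm po) pm (≤-<-trans z≤n (toℕ<n i)) mov<opp′

  StaysOutnumbered : List ℕ → List ℕ → Set
  StaysOutnumbered mov opp = ∀ i j → length mov < length (attack n mov opp i j)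

  stays-outnumbered-by-two : ∀ mov opp → suc (length mov) < length opp →
                             StaysOutnumbered mov opp
  stays-outnumbered-by-two mov opp 1+mov<opp i j =
    s≤s⁻¹ (<-≤-trans 1+mov<opp (length-attack-≥ mov opp i j))

  stays-outnumbered-harmless : ∀ mov opp → Harmless opp mov → length mov < length opp →
                               StaysOutnumbered mov opp
  stays-outnumbered-harmless mov opp harmless mov<opp i j = subst (length mov <_)
    (sym (length-attack-tap mov opp i j (harmless-attack-sum mov opp i j harmless))) mov<opp

  stays-outnumbered⇒loses : ∀ opp mov → OutnumberingWinsBelow (potential opp + potential mov) →
                            Positive opp → Positive mov → StaysOutnumbered mov opp →
                            MoverLoses n mov opp
  stays-outnumbered⇒loses opp mov ih po pm stays =
    allMoves λ i j → wins-after-outnumbered-reply opp mov i j ih po pm (stays i j)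

  wins-by-move : ∀ xs ys i j → OutnumberingWinsBelow (potential xs + potential ys) →
                 Positive xs → Positive ys → StaysOutnumbered (attack n xs ys i j) xs →
                 MoverWins n xs ys
  wins-by-move xs ys i j ih px py stays = move i j
    (stays-outnumbered⇒loses xs (attack n xs ys i j) (below-after-attack xs ys i j px ih)
      px (positive-attack xs ys i j px py) stays)

  wins-by-kill-into-harmless : ∀ xs ys j {x} → OutnumberingWinsBelow (potential xs + potential ys) →
                               Positive xs → Positive ys → x ∈ xs → n < lookup ys j + x →
                               Harmless xs (removeAt ys j) → length ys ≤ length xs →
                               MoverWins n xs ys
  wins-by-kill-into-harmless xs ys j ih px py x∈xs kill harmless ys≤xs =
    wins-by-move xs ys i j ih px py (stays-outnumbered-harmless ys′ xs harmless′ ys′<xs)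
    where
    i = index x∈xs
    ys′ = attack n xs ys i j
    kill′ : n < attack-sum xs ys i j
    kill′ = subst (λ x → n < lookup ys j + x) (lookup-index x∈xs) kill
    harmless′ : Harmless xs ys′
    harmless′ = subst (Harmless xs) (sym (attack-kill xs ys i j kill′)) harmless
    ys′<xs : length ys′ < length xs
    ys′<xs = subst (_≤ length xs) (sym (length-attack-kill xs ys i j kill′)) ys≤xs

  attacker≡new-hand : ∀ ys xs a b {v zs} → ys ↭ v ∷ zs → Harmless xs zs →
                      n < attack-sum ys xs a b → lookup ys a ≡ v
  attacker≡new-hand ys xs a b ys↭ harmless kill with ∈-resp-↭ ys↭ (∈-lookup a)
  ... | here  y≡v  = y≡v
  ... | there y∈zs = contradiction kill (≤⇒≯ (harmless (∈-lookup b) y∈zs))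

  wins-by-retaliation : ∀ xs ys a b {v zs} → OutnumberingWinsBelow (potential xs + potential ys) →
                        Positive xs → Positive ys → ys ↭ v ∷ zs → Harmless xs zs →
                        CanRetaliate xs v → length ys < length xs → n < attack-sum ys xs a b →
                        MoverWins n (attack n ys xs a b) ys
  wins-by-retaliation xs ys a b ih px py ys↭ harmless retaliate ys<xs kill
    with attacker≡new-hand ys xs a b ys↭ harmless kill
  ... | refl with retaliate b kill
  ... | x , x∈rest , n<y+x = wins-by-kill-into-harmless xs′ ys a ih′
          (positive-attack ys xs a b py px) py x∈xs′ n<y+x harmless′ ys≤xs′
    where
    xs′ = attack n ys xs a b
    ih′ : OutnumberingWinsBelow (potential xs′ + potential ys)
    ih′ = below-≤ (<⇒≤ (+-monoˡ-< (potential ys) (potential-attack ys xs a b py))) ih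
    x∈xs′ : x ∈ xs′
    x∈xs′ = subst (x ∈_) (sym (attack-kill ys xs a b kill)) x∈rest
    harmless′ : Harmless xs′ (removeAt ys a)
    harmless′ = harmless-⊆ (attack-kill-⊆ ys xs a b kill)
                  (∈-resp-↭ (removeAt-cancel ys a ys↭)) harmless
    ys≤xs′ : length ys ≤ length xs′
    ys≤xs′ = s≤s⁻¹ (subst (length ys <_) (sym (length-attack-kill ys xs a b kill)) ys<xs)

  loses-to-retaliation : ∀ xs ys {v zs} → OutnumberingWinsBelow (potential xs + potential ys) →
                         Positive xs → Positive ys → ys ↭ v ∷ zs → Harmless xs zs →
                         CanRetaliate xs v → length ys < length xs → MoverLoses n ys xs
  loses-to-retaliation xs ys ih px py ys↭ harmless retaliate ys<xs = allMoves reply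
    where
    reply : ∀ a b → MoverWins n (attack n ys xs a b) ys
    reply a b with n <? attack-sum ys xs a b
    ... | yes kill  = wins-by-retaliation xs ys a b ih px py ys↭ harmless retaliate ys<xs kill
    ... | no  ¬kill = wins-after-outnumbered-reply xs ys a b ih px py
      (subst (length ys <_) (sym (length-attack-tap ys xs a b (≮⇒≥ ¬kill))) ys<xs)

  wins-by-retaliating-tap : ∀ xs ys i j → OutnumberingWinsBelow (potential xs + potential ys) →
                            Positive xs → Positive ys → Harmless ys xs →
                            CanRetaliate xs (attack-sum xs ys i j) → length ys < length xs →
                            MoverWins n xs ys
  wins-by-retaliating-tap xs ys i j ih px py harmless retaliate ys<xs = move i j
    (loses-to-retaliation xs ys′ (below-after-attack xs ys i j px ih) px
      (positive-attack xs ys i j px py) (attack-tap-↭ xs ys i j tap)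
      (harmless-⊆ id (removeAt-⊆ ys j) (harmless-sym harmless)) retaliate ys′<xs)
    where
    ys′ = attack n xs ys i j
    tap = harmless-attack-sum xs ys i j harmless
    ys′<xs : length ys′ < length xs
    ys′<xs = subst (_< length xs) (sym (length-attack-tap xs ys i j tap)) ys<xs

  outnumbering-wins-step : ∀ {xs ys} → OutnumberingWinsBelow (potential xs + potential ys) →
                           OutnumberingWins xs ys
  outnumbering-wins-step {xs} {ys} ih px py 1≤∣ys∣ ys<xs with kill-or-harmless xs ys
  ... | inj₁ (i , j , kill) = wins-by-move xs ys i j ih px py
    (stays-outnumbered-by-two (attack n xs ys i j) xs
      (subst (_< length xs) (sym (length-attack-kill xs ys i j kill)) ys<xs))
  ... | inj₂ harmless =
    let j               = fromℕ< 1≤∣ys∣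
        (i , retaliate) = ∃-retaliating-tap (lookup ys j) xs (≤-<-trans 1≤∣ys∣ ys<xs)
    in  wins-by-retaliating-tap xs ys i j ih px py harmless retaliate ys<xs

  outnumbering-mover-wins : ∀ {xs ys} → Acc _<_ (potential xs + potential ys) →
                            OutnumberingWins xs ys
  outnumbering-mover-wins (acc rs) =
    outnumbering-wins-step (λ p<k → outnumbering-mover-wins (rs p<k))

theorem3p1 : (n : ℕ) (xs ys : List ℕ) → 1 ≤ n → 1 ≤ length xs → 1 ≤ length ys →
    ValidHands n xs → ValidHands n ys →
    (length ys < length xs → LeftWinsMovingFirst n xs ys) ×
    (length xs < length ys → RightWinsMovingFirst n xs ys)
theorem3p1 n xs ys _ 1≤∣xs∣ 1≤∣ys∣ (_ , bounds-xs) (_ , bounds-ys) =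
  (λ ys<xs → outnumbering-mover-wins n (<-wellFounded _) px py 1≤∣ys∣ ys<xs) ,
  (λ xs<ys → outnumbering-mover-wins n (<-wellFounded _) py px 1≤∣xs∣ xs<ys)
  where
  px = All.map proj₁ bounds-xs
  py = All.map proj₁ bounds-ys
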